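{- For each complete orthomodular lattice $\mathcal M=(M,\le,{}^\perp)$ let $\mu_{\mathcal M}=\delta_{\mathcal M}:\mathcal M\to\Psi(\Gamma(\mathcal M))$ be given by $\delta_{\mathcal M}(m)=\{\pi_m\}$. Then $\mu=(\mu_{\mathcal M})_{\mathcal M}$ is a natural isomorphism from the identity functor $1_{\mathbb{COL}}$ to $\Psi\circ\Gamma$.
   Context: A unital involutive quantale $(K,\bigsqcup,\odot,{}^*,e)$: complete join-semilattice (binary join $\sqcup$), associative $\odot$ distributing over arbitrary joins on both sides, unit $e$, involution with $x^{**}=x$, $(x\odot y)^*=y^*\odot x^*$, $(\bigsqcup x_i)^*=\bigsqcup x_i^*$. An involutive generalized dynamic algebra (IDA) is $(K,\bigsqcup,\odot,{}^*,{\sim},e)$ with such a quantale and ${\sim}:K\to K$ satisfying for all $x,y$ and families $(x_i)$: ${\sim}(x\odot{\sim}{\sim}y)={\sim}(x\odot y)$; ${\sim}(\bigsqcup_i{\sim}{\sim}x_i)={\sim}(\bigsqcup_ix_i)$; $({\sim}x)^*={\sim}x$; ${\sim}{\sim}({\sim}{\sim}x\odot y)={\sim}({\sim}x\sqcup{\sim}({\sim}x\sqcup y))$. Notation: $\widetilde K=\{{\sim}k\}$; $\bigvee W={\sim}{\sim}\bigsqcup W$; $k\preceq l$ iff $\bigvee\{k,l\}=l$; $w^\perp={\sim}w$; $k\bullet v={\sim}{\sim}(k\odot v)$; $k\equiv l$ iff $k\bullet w=l\bullet w$ for all $w\in\widetilde K$. IDA morphisms preserve arbitrary joins, $\odot$,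 unit, ${}^*$, ${\sim}$. Semi-Foulis: $(\widetilde K,\preceq,{}^\perp)$ is a complete orthomodular lattice (OML). For a complete OML $\mathcal M$ with Sasaki projections $\pi_m(x)=m\wedge(m^\perp\vee x)$, $\mathbf{Lin}(\mathcal M)$ is the set of maps $f:M\to M$ admitting $f^*$ with $f(x)\le y^\perp\iff x\le f^*(y)^\perp$, with pointwise joins, $\odot=\circ$, involution $f^*$, unit $\mathrm{id}_M$, ${\sim}f=\pi_{f(1)^\perp}$ (an IDA). For an involutive submonoid $L\subseteq\mathbf{Lin}(\mathcal M)$ containing all $\pi_m$, $\mathscr P(L)$ is the IDA of subsets of $L$ with union, $A\odot B=\{a\circ b\}$, $A^*=\{a^*\}$, ${\sim}A=\{\pi_{(\bigvee_{a\in A}a(1))^\perp}\}$, unit $\{\mathrm{id}_M\}$. $\mathbb{IM}$: involutive monoids with maps preserving product, unit, involution. Fix a functor $\mathscr T$ from IDAs to $\mathbb{IM}$ with: (T1) $\widetilde K\subseteq\mathscr T(K)\subseteq K$, $\mathscr T(K)$ an involutive submonoid; (T2) for every semi-Foulis $\mathfrak K$ with $s=t\iff s\equiv t$ on $\mathscr T(K)$, $\nu_{\mathfrak K}(k)=k\bullet(-)$ is an $\mathbb{IM}$-isomorphism $\mathscr T(\mathfrak K)\to\mathscr T(\mathbf{Lin}(\widetilde K,\preceq,{}^\perp))$; (T3) for every complete OML $\mathcal M$, $f\mapsto\{f\}$ is an $\mathbb{IM}$-isomorphism $\mathscr T(\mathbf{Lin}(\mathcal M))\to\mathscr T(\mathscr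 P(\mathscr T(\mathbf{Lin}(\mathcal M))))$; (T4) $\mathscr T(f)$ is the restriction of $f$. A $\mathscr T$-based orthomodular dynamic algebra is an IDA with: (TODA1) $(\widetilde K,\preceq,{}^\perp)$ complete OML; (TODA2) any $A$ with $\mathscr T(K)\subseteq A\subseteq K$ closed under $\odot$, ${}^*$, arbitrary joins equals $K$; (TODA3) for $S,T\subseteq\mathscr T(K)$, $\bigsqcup S=\bigsqcup T$ iff $S=T$; (TODA4) for $s,t\in\mathscr T(K)$, $s=t$ iff $s\equiv t$. $\mathscr T\mathbb{ODA}$: these algebras with bijective IDA morphisms. $\mathbb{COL}$: complete OMLs with ortholattice isomorphisms (bijections $k$ with $m\le n\iff k(m)\le k(n)$, $k(m^\perp)=k(m)^\perp$). Functors: $\Gamma:\mathbb{COL}\to\mathscr T\mathbb{ODA}$, $\Gamma(\mathcal M)=\mathscr P(\mathscr T(\mathbf{Lin}(\mathcal M)))$, $\Gamma(k)(A)=\{k\circ a\circ k^{ -1}:a\in A\}$; $\Psi:\mathscr T\mathbb{ODA}\to\mathbb{COL}$, $\Psi(\mathfrak K)=(\widetilde K,\preceq,{}^\perp)$, $\Psi(\phi)=\phi|_{\widetilde K}$. -}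

module Defs where

open import Level using (Level; suc; Lift)
open import Data.Empty using (⊥)
open import Data.Product using (Σ; ∃; _×_; _,_)
open import Data.Sum using (_⊎_)
open import Relation.Unary using (Pred; _⊆_)
open import Relation.Binary.Structures using (IsPartialOrder)
open import Relation.Binary.PropositionalEquality using (_≡_)

module _ {ℓ : Level} {A : Set ℓ} (⋁ : Pred A ℓ → A) (_ᗮ : A → A) where
  join₂ : A → A → A
  join₂ x y = ⋁ (λ z → (z ≡ x) ⊎ (z ≡ y))

  meet₂ : A → A → A
  meet₂ x y = (join₂ (x ᗮ) (y ᗮ)) ᗮ

  bot : A
  bot = ⋁ (λ _ → Lift ℓ ⊥)

  top : A
  top = bot ᗮ

record CompleteOML (ℓ : Level) : Set (suc ℓ) where
  field
    Carrier        : Set ℓ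
    _≤_            : Carrier → Carrier → Set ℓ
    isPartialOrder : IsPartialOrder _≡_ _≤_
    _ᗮ             : Carrier → Carrier
    ⋁              : Pred Carrier ℓ → Carrier
    ⋁-upper        : ∀ (P : Pred Carrier ℓ) x → P x → x ≤ ⋁ P
    ⋁-least        : ∀ (P : Pred Carrier ℓ) y → (∀ x → P x → x ≤ y) → ⋁ P ≤ y
    ᗮ-involutive   : ∀ x → (x ᗮ) ᗮ ≡ x
    ᗮ-antitone     : ∀ x y → x ≤ y → (y ᗮ) ≤ (x ᗮ)
    ᗮ-complement   : ∀ x → meet₂ ⋁ _ᗮ x (x ᗮ) ≡ bot ⋁ _ᗮ
    orthomodular   : ∀ x y → x ≤ y → y ≡ join₂ ⋁ _ᗮ x (meet₂ ⋁ _ᗮ (x ᗮ) y)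

  _∨_ : Carrier → Carrier → Carrier
  _∨_ = join₂ ⋁ _ᗮ

  _∧_ : Carrier → Carrier → Carrier
  _∧_ = meet₂ ⋁ _ᗮ

  𝟎 𝟏 : Carrier
  𝟎 = bot ⋁ _ᗮ
  𝟏 = top ⋁ _ᗮ

  π : Carrier → Carrier → Carrier
  π m x = m ∧ ((m ᗮ) ∨ x)

∣_∣ : {ℓ : Level} → CompleteOML ℓ → Set ℓ
∣ M ∣ = CompleteOML.Carrier M

record Lin {ℓ : Level} (M : CompleteOML ℓ) : Set ℓ where
  open CompleteOML M
  field
    fun     : Carrier → Carrier
    adj     : Carrier → Carrier
    adjoint : ∀ x y → ((fun x ≤ (y ᗮ)) → (x ≤ (adj y ᗮ)))
                    × ((x ≤ (adj y ᗮ)) → (fun x ≤ (y ᗮ)))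
open Lin public

module _ {ℓ : Level} {M : CompleteOML ℓ} where
  open CompleteOML M

  _≈L_ : Lin M → Lin M → Set ℓ
  f ≈L g = ∀ x → fun f x ≡ fun g x

  Sub : Set (suc ℓ)
  Sub = Pred (Lin M) ℓ

  _≐_ : Sub → Sub → Set ℓ
  X ≐ Y = (X ⊆ Y) × (Y ⊆ X)

  -- the singleton {f} for a map f : M → M (as a subset of Lin(M))
  ⟦_⟧ : (Carrier → Carrier) → Sub
  ⟦ h ⟧ g = ∀ x → fun g x ≡ h x

  _∪_ : Sub → Sub → Sub
  (X ∪ Y) g = X g ⊎ Y g

  ∼ : Sub → Sub
  ∼ A = ⟦ π ((⋁ (λ x → ∃ λ (a : Lin M) → A a × (fun a 𝟏 ≡ x))) ᗮ) ⟧

  -- the order ⪯ of the IDA 𝒫(L):  X ⪯ Y  iff  ⋁{X,Y} = ~~(X ∪ Y) = Y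
  _⪯_ : Sub → Sub → Set ℓ
  X ⪯ Y = ∼ (∼ (X ∪ Y)) ≐ Y

  δ : Carrier → Sub
  δ m = ⟦ π m ⟧

-- The functor 𝒯, as far as it enters Γ(M) = 𝒫(𝒯(Lin M)):
-- for each complete OML M, an involutive submonoid 𝒯(Lin M) of Lin(M)
-- containing the ~-image of Lin(M) (condition (T1)).

record TFamily (ℓ : Level) : Set (suc ℓ) where
  field
    T        : (M : CompleteOML ℓ) → Pred (Lin M) ℓ
    T-resp   : ∀ M (f g : Lin M) → f ≈L g → T M f → T M g
    T-unit   : ∀ M (f : Lin M) → (∀ x → fun f x ≡ x) → T M f
    T-comp   : ∀ M (f g h : Lin M) → T M f → T M g
               → (∀ x → fun h x ≡ fun f (fun g x)) → T M h
    T-invol  : ∀ M (f g : Lin M) → T M f → (∀ x → fun g x ≡ adj f x) → T M g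
    -- (T1):  ~f = π_{f(1)ᗮ} ∈ 𝒯(Lin M) for every f ∈ Lin M
    T-tilde  : ∀ M (f g : Lin M)
               → (∀ x → fun g x ≡ CompleteOML.π M (CompleteOML._ᗮ M (fun f (CompleteOML.𝟏 M))) x)
               → T M g
open TFamily public

module _ {ℓ : Level} {M : CompleteOML ℓ} where
  -- X is an element of Ψ(Γ(M)), i.e. X = ~A for some A ∈ Γ(M) = 𝒫(𝒯(Lin M))
  InΨΓ : Pred (Lin M) ℓ → Sub {M = M} → Set (suc ℓ)
  InΨΓ TM X = Σ (Sub {M = M}) λ A → (A ⊆ TM) × (X ≐ ∼ A)

record OrthoIso {ℓ : Level} (M N : CompleteOML ℓ) : Set ℓ where
  private
    module M = CompleteOML M
    module N = CompleteOML N
  field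
    to       : M.Carrier → N.Carrier
    from     : N.Carrier → M.Carrier
    from-to  : ∀ x → from (to x) ≡ x
    to-from  : ∀ y → to (from y) ≡ y
    mono     : ∀ x y → x M.≤ y → to x N.≤ to y
    reflect  : ∀ x y → to x N.≤ to y → x M.≤ y
    pres-ᗮ   : ∀ x → to (x M.ᗮ) ≡ (to x) N.ᗮ
open OrthoIso public

Γmap : {ℓ : Level} {M N : CompleteOML ℓ} → OrthoIso M N → Sub {M = M} → Sub {M = N}
Γmap {M = M} k A g = ∃ λ (a : Lin M) → A a × (∀ y → fun g y ≡ to k (fun a (from k y)))

-- Sasaki projections are self-adjoint (by orthomodularity), so every π_m lies in
-- Lin(M), and π_m(1) = m recovers m from {π_m}.  Since ~A is by definition
-- {π_c} with c = (⋁_{a∈A} a(1))ᗮ, every element of Ψ(Γ(M)) is some δ(c); and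
-- computing ⋁ on singletons of Sasaki projections shows that ~ and the order ⪯
-- of Ψ(Γ(M)) correspond under δ to ᗮ and ≤.  Naturality holds because an
-- ortholattice isomorphism k preserves ∨, ∧ and ᗮ, hence k ∘ π_m ∘ k⁻¹ = π_{k(m)}.

module Submission where

open import Defs
open import Level using (Level; lift)
open import Data.Product using (∃; _×_; _,_)
open import Data.Sum using (inj₁; inj₂)
open import Relation.Binary.Bundles using (Poset)
open import Relation.Binary.Structures using (IsPartialOrder)
open import Relation.Binary.PropositionalEquality
  using (_≡_; refl; sym; trans; cong; cong₂; subst; module ≡-Reasoning)
open import Relation.Unary using (Pred)
open import Relation.Unary.Properties using (≐-refl; ≐-sym; ≐-trans)

-- The operators of CompleteOML carry no fixity declarations.
module OMLNotation {ℓ : Level} (M : CompleteOML ℓ) = CompleteOML M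
  renaming ( _≤_ to infix 4 _≤_ ; _ᗮ to infixl 10 _ᗮ
           ; _∨_ to infixr 6 _∨_ ; _∧_ to infixr 7 _∧_ )

module CompleteOMLProperties {ℓ : Level} (M : CompleteOML ℓ) where
  open OMLNotation M

  private
    poset : Poset ℓ ℓ ℓ
    poset = record { isPartialOrder = isPartialOrder }

  open IsPartialOrder isPartialOrder public
    using ()
    renaming (refl to ≤-refl; reflexive to ≤-reflexive; trans to ≤-trans; antisym to ≤-antisym)
  open import Relation.Binary.Reasoning.PartialOrder poset

  ≤ᗮ-sym : ∀ {x y} → x ≤ y ᗮ → y ≤ x ᗮ
  ≤ᗮ-sym {x} {y} p = subst (_≤ x ᗮ) (ᗮ-involutive y) (ᗮ-antitone _ _ p)

  ᗮ≤-sym : ∀ {x y} → x ᗮ ≤ y → y ᗮ ≤ x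
  ᗮ≤-sym {x} {y} p = subst (y ᗮ ≤_) (ᗮ-involutive x) (ᗮ-antitone _ _ p)

  x≤x∨y : ∀ x y → x ≤ x ∨ y
  x≤x∨y x y = ⋁-upper _ x (inj₁ refl)

  y≤x∨y : ∀ x y → y ≤ x ∨ y
  y≤x∨y x y = ⋁-upper _ y (inj₂ refl)

  ∨-least : ∀ {x y z} → x ≤ z → y ≤ z → x ∨ y ≤ z
  ∨-least {z = z} p q = ⋁-least _ z λ { _ (inj₁ refl) → p ; _ (inj₂ refl) → q }

  x∧y≤x : ∀ x y → x ∧ y ≤ x
  x∧y≤x x y = ᗮ≤-sym (x≤x∨y (x ᗮ) (y ᗮ))

  ∧-greatest : ∀ {x y z} → z ≤ x → z ≤ y → z ≤ x ∧ y
  ∧-greatest p q = ≤ᗮ-sym (∨-least (ᗮ-antitone _ _ p) (ᗮ-antitone _ _ q))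

  ∨-monoʳ : ∀ a {x y} → x ≤ y → a ∨ x ≤ a ∨ y
  ∨-monoʳ a {y = y} p = ∨-least (x≤x∨y a y) (≤-trans p (y≤x∨y a y))

  x≤y⇒x∨y≡y : ∀ {x y} → x ≤ y → x ∨ y ≡ y
  x≤y⇒x∨y≡y {x} {y} p = ≤-antisym (∨-least p ≤-refl) (y≤x∨y x y)

  x≤𝟏 : ∀ x → x ≤ 𝟏
  x≤𝟏 x = ≤ᗮ-sym (⋁-least _ (x ᗮ) λ { _ (lift ()) })

  ⋁-≡ : ∀ (P : Carrier → Set ℓ) {c} → P c → (∀ x → P x → x ≡ c) → ⋁ P ≡ c
  ⋁-≡ P {c} Pc unique =
    ≤-antisym (⋁-least P c λ x Px → ≤-reflexive (unique x Px)) (⋁-upper P c Pc)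

  π≤ : ∀ m x → π m x ≤ m
  π≤ m x = x∧y≤x m _

  π-𝟏 : ∀ m → π m 𝟏 ≡ m
  π-𝟏 m = ≤-antisym (π≤ m 𝟏) (∧-greatest ≤-refl (≤-trans (x≤𝟏 m) (y≤x∨y _ 𝟏)))

  ≤ᗮ∨π : ∀ m x → x ≤ m ᗮ ∨ π m x
  ≤ᗮ∨π m x = begin
    x                                     ≤⟨ y≤x∨y (m ᗮ) x ⟩
    m ᗮ ∨ x                               ≡⟨ orthomodular (m ᗮ) (m ᗮ ∨ x) (x≤x∨y (m ᗮ) x) ⟩
    m ᗮ ∨ ((m ᗮ) ᗮ ∧ (m ᗮ ∨ x))           ≡⟨ cong (λ u → m ᗮ ∨ (u ∧ (m ᗮ ∨ x))) (ᗮ-involutive m) ⟩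
    m ᗮ ∨ π m x                           ∎

  π-adjointˡ : ∀ m x y → π m x ≤ y ᗮ → x ≤ π m y ᗮ
  π-adjointˡ m x y p = begin
    x                        ≤⟨ ≤ᗮ∨π m x ⟩
    m ᗮ ∨ π m x              ≤⟨ ∨-monoʳ (m ᗮ) (≤ᗮ-sym (∨-least (ᗮ-antitone _ _ (π≤ m x)) (≤ᗮ-sym p))) ⟩
    m ᗮ ∨ (m ᗮ ∨ y) ᗮ        ≡⟨ sym (ᗮ-involutive _) ⟩
    π m y ᗮ                  ∎

  -- The converse is the same implication with x and y exchanged.
  π-adjoint : ∀ m x y → (π m x ≤ y ᗮ → x ≤ π m y ᗮ) × (x ≤ π m y ᗮ → π m x ≤ y ᗮ)
  π-adjoint m x y =
    π-adjointˡ m x y , λ q → ≤ᗮ-sym (π-adjointˡ m y x (≤ᗮ-sym q))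

  πLin : Carrier → Lin M
  πLin m = record { fun = π m ; adj = π m ; adjoint = π-adjoint m }

  ⋁at𝟏 : Sub {M = M} → Carrier
  ⋁at𝟏 A = ⋁ λ x → ∃ λ (a : Lin M) → A a × (fun a 𝟏 ≡ x)

  δ-at-𝟏 : ∀ c a → δ {M = M} c a → fun a 𝟏 ≡ c
  δ-at-𝟏 c a a∈δc = trans (a∈δc 𝟏) (π-𝟏 c)

  δ-cong : ∀ {c d} → c ≡ d → δ {M = M} c ≐ δ d
  δ-cong refl = ≐-refl

  ⋁at𝟏-δ : ∀ c → ⋁at𝟏 (δ c) ≡ c
  ⋁at𝟏-δ c = ⋁-≡ _ (πLin c , (λ _ → refl) , π-𝟏 c)
    λ { x (a , a∈δc , refl) → δ-at-𝟏 c a a∈δc }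

  ⋁at𝟏-δ∪δ : ∀ m n → ⋁at𝟏 (δ m ∪ δ n) ≡ m ∨ n
  ⋁at𝟏-δ∪δ m n = ≤-antisym
    (⋁-least _ _ λ
      { _ (a , inj₁ a∈δm , refl) → subst (_≤ m ∨ n) (sym (δ-at-𝟏 m a a∈δm)) (x≤x∨y m n)
      ; _ (a , inj₂ a∈δn , refl) → subst (_≤ m ∨ n) (sym (δ-at-𝟏 n a a∈δn)) (y≤x∨y m n) })
    (∨-least (⋁-upper _ m (πLin m , inj₁ (λ _ → refl) , π-𝟏 m))
             (⋁-upper _ n (πLin n , inj₂ (λ _ → refl) , π-𝟏 n)))

  ∼-δ : ∀ c → ∼ (δ c) ≐ δ (c ᗮ)
  ∼-δ c = δ-cong (cong _ᗮ (⋁at𝟏-δ c))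

  -- ∼ (δ m ∪ δ n) is literally δ ((⋁at𝟏 (δ m ∪ δ n)) ᗮ).
  ∼∼-δ∪δ : ∀ m n → ∼ (∼ (δ m ∪ δ n)) ≐ δ (m ∨ n)
  ∼∼-δ∪δ m n = ≐-trans (∼-δ _)
    (δ-cong (trans (ᗮ-involutive _) (⋁at𝟏-δ∪δ m n)))

  δ-injective : ∀ m n → δ {M = M} m ≐ δ n → m ≡ n
  δ-injective m n (δm⊆δn , _) =
    trans (sym (π-𝟏 m)) (δ-at-𝟏 n (πLin m) (δm⊆δn {πLin m} λ _ → refl))

  δ-mono : ∀ {m n} → m ≤ n → δ {M = M} m ⪯ δ n
  δ-mono {m} {n} m≤n = ≐-trans (∼∼-δ∪δ m n) (δ-cong (x≤y⇒x∨y≡y m≤n))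

  δ-reflects-≤ : ∀ {m n} → δ {M = M} m ⪯ δ n → m ≤ n
  δ-reflects-≤ {m} {n} δm⪯δn =
    subst (m ≤_) (δ-injective _ _ (≐-trans (≐-sym (∼∼-δ∪δ m n)) δm⪯δn)) (x≤x∨y m n)

  δ-ᗮ : ∀ m → δ {M = M} (m ᗮ) ≐ ∼ (δ m)
  δ-ᗮ m = ≐-sym (∼-δ m)

  δ∈ΨΓ : (𝒯 : TFamily ℓ) → ∀ m → InΨΓ (T 𝒯 M) (δ {M = M} m)
  δ∈ΨΓ 𝒯 m = δ (m ᗮ) , δmᗮ⊆T
           , ≐-trans (δ-cong (sym (ᗮ-involutive m))) (≐-sym (∼-δ (m ᗮ)))
    where
    δmᗮ⊆T : ∀ {g} → δ (m ᗮ) g → T 𝒯 M g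
    δmᗮ⊆T {g} g∈δmᗮ = T-tilde 𝒯 M (πLin m) g
      λ x → trans (g∈δmᗮ x) (cong (λ u → π (u ᗮ) x) (sym (π-𝟏 m)))

  ΨΓ⊆δ-image : ∀ {TM : Pred (Lin M) ℓ} (X : Sub {M = M}) →
               InΨΓ TM X → ∃ λ (m : Carrier) → δ m ≐ X
  ΨΓ⊆δ-image X (A , _ , X≐∼A) = _ , ≐-sym X≐∼A

module OrthoIsoProperties {ℓ : Level} {M N : CompleteOML ℓ} (k : OrthoIso M N) where
  private
    module M = OMLNotation M
    module N = OMLNotation N
    module PM = CompleteOMLProperties M
    module PN = CompleteOMLProperties N
  open ≡-Reasoning

  to≤⇒≤from : ∀ {x y} → to k x N.≤ y → x M.≤ from k y
  to≤⇒≤from {x} {y} p = reflect k _ _ (subst (to k x N.≤_) (sym (to-from k y)) p)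

  to-∨ : ∀ a b → to k (a M.∨ b) ≡ to k a N.∨ to k b
  to-∨ a b = PN.≤-antisym
    (subst (to k (a M.∨ b) N.≤_) (to-from k _)
      (mono k _ _ (PM.∨-least (to≤⇒≤from (PN.x≤x∨y _ _)) (to≤⇒≤from (PN.y≤x∨y _ _)))))
    (PN.∨-least (mono k _ _ (PM.x≤x∨y a b)) (mono k _ _ (PM.y≤x∨y a b)))

  to-∧ : ∀ a b → to k (a M.∧ b) ≡ to k a N.∧ to k b
  to-∧ a b = begin
    to k ((a M.ᗮ M.∨ b M.ᗮ) M.ᗮ)          ≡⟨ pres-ᗮ k _ ⟩
    to k (a M.ᗮ M.∨ b M.ᗮ) N.ᗮ            ≡⟨ cong N._ᗮ (to-∨ _ _) ⟩
    (to k (a M.ᗮ) N.∨ to k (b M.ᗮ)) N.ᗮ   ≡⟨ cong N._ᗮ (cong₂ N._∨_ (pres-ᗮ k a) (pres-ᗮ k b)) ⟩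
    (to k a N.ᗮ N.∨ to k b N.ᗮ) N.ᗮ       ∎

  to-π : ∀ m x → to k (M.π m x) ≡ N.π (to k m) (to k x)
  to-π m x = begin
    to k (m M.∧ (m M.ᗮ M.∨ x))               ≡⟨ to-∧ _ _ ⟩
    to k m N.∧ to k (m M.ᗮ M.∨ x)            ≡⟨ cong (to k m N.∧_) (to-∨ _ _) ⟩
    to k m N.∧ (to k (m M.ᗮ) N.∨ to k x)     ≡⟨ cong (λ u → to k m N.∧ (u N.∨ to k x)) (pres-ᗮ k m) ⟩
    to k m N.∧ (to k m N.ᗮ N.∨ to k x)       ∎

  conjugate-π : ∀ m y → to k (M.π m (from k y)) ≡ N.π (to k m) y
  conjugate-π m y = trans (to-π m (from k y)) (cong (N.π (to k m)) (to-from k y))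

  Γmap-δ : ∀ m → Γmap k (δ {M = M} m) ≐ δ {M = N} (to k m)
  Γmap-δ m =
    (λ { (a , a∈δm , g≡kak⁻¹) y →
           trans (g≡kak⁻¹ y) (trans (cong (to k) (a∈δm (from k y))) (conjugate-π m y)) })
    , λ g∈δkm → PM.πLin m , (λ _ → refl) , λ y → trans (g∈δkm y) (sym (conjugate-π m y))

theorem6p2 : ∀ {ℓ : Level} (𝒯 : TFamily ℓ) →
    (∀ (M : CompleteOML ℓ) →
        (∀ (m : ∣ M ∣) → InΨΓ (T 𝒯 M) (δ {M = M} m))
      × (∀ (m n : ∣ M ∣) → δ {M = M} m ≐ δ n → m ≡ n)
      × (∀ (X : Sub {M = M}) → InΨΓ (T 𝒯 M) X → ∃ λ (m : ∣ M ∣) → δ m ≐ X)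
      × (∀ (m n : ∣ M ∣) →
            (CompleteOML._≤_ M m n → δ {M = M} m ⪯ δ n)
          × (δ {M = M} m ⪯ δ n → CompleteOML._≤_ M m n))
      × (∀ (m : ∣ M ∣) → δ {M = M} (CompleteOML._ᗮ M m) ≐ ∼ (δ m)))
    × (∀ (M N : CompleteOML ℓ) (k : OrthoIso M N) (m : ∣ M ∣) →
          Γmap k (δ {M = M} m) ≐ δ {M = N} (to k m))
theorem6p2 𝒯 =
    (λ M → let open CompleteOMLProperties M in
       δ∈ΨΓ 𝒯 , δ-injective , ΨΓ⊆δ-image , (λ m n → δ-mono , δ-reflects-≤) , δ-ᗮ)
  , λ M N k → OrthoIsoProperties.Γmap-δ k
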